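{- For every integer $k\ge 3$, there exists a majority neighbor sum distinguishing $4$-edge-coloring $c$ of $K_{2k}$ such that, if $(v_1,\dots,v_{2k})$ is the ordering of the vertices of $K_{2k}$ with $\sigma_c(v_i)<\sigma_c(v_j)$ for all $i<j$, then $v_k$ is incident to at most $k-2$ edges of color $2$, or $v_{k+1}$ is incident to at most $k-2$ edges of color $3$.
   Context: A $k$-edge-coloring of a graph $G$ is any map $c:E(G)\to[k]$ (adjacent edges may receive the same color). It induces $\sigma_c(v)=\sum_{u\in N(v)}c(vu)$. The coloring is neighbor sum distinguishing if $\sigma_c(u)\ne\sigma_c(v)$ for every edge $uv$ (so in a complete graph all vertex sums are distinct), and majority if every vertex $v$ is incident to at most $d(v)/2$ edges of each color. -}

module Defs where

open import Data.Nat using (ℕ; zero; suc; _+_; _*_; _≤_; _<_)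
open import Data.Fin using (Fin; toℕ)
open import Data.List using (List; map; filter; length)
open import Data.Nat.ListAction using (sum)
open import Data.List using () renaming (allFin to allFinL)
open import Data.Product using (_×_)
open import Relation.Binary.PropositionalEquality using (_≡_)
open import Relation.Nullary using (¬_)
open import Data.Fin using (_≟_)
open import Data.Nat using () renaming (_≟_ to _≟ℕ_)
open import Relation.Nullary.Decidable using (¬?)

-- An edge-coloring of the complete graph K_n on vertex set Fin n is
-- represented by a function c : Fin n → Fin n → ℕ; only values on pairs
-- u ≢ v matter (the diagonal is ignored).
EdgeCol : ℕ → Set
EdgeCol n = Fin n → Fin n → ℕ

IsEdgeColoring : (n k : ℕ) → EdgeCol n → Set
IsEdgeColoring n k c =
  (∀ u v → ¬ (u ≡ v) → c u v ≡ c v u) ×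
  (∀ u v → ¬ (u ≡ v) → (1 ≤ c u v) × (c u v ≤ k))

nbrs : {n : ℕ} → Fin n → List (Fin n)
nbrs {n} v = filter (λ u → ¬? (u ≟ v)) (allFinL n)

σ : {n : ℕ} → EdgeCol n → Fin n → ℕ
σ c v = sum (map (c v) (nbrs v))

colDeg : {n : ℕ} → EdgeCol n → Fin n → ℕ → ℕ
colDeg c v i = length (filter (λ u → c v u ≟ℕ i) (nbrs v))

-- neighbour sum distinguishing (in K_n: all vertices adjacent)
IsNSD : (n : ℕ) → EdgeCol n → Set
IsNSD n c = ∀ u v → ¬ (u ≡ v) → ¬ (σ c u ≡ σ c v)

IsMajority : (n : ℕ) → EdgeCol n → Set
IsMajority n c = ∀ v i → 2 * colDeg c v i ≤ length (nbrs v)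

-- index helpers: 0-based positions k-1 and k in Fin (k + k) (i.e. v_k and v_{k+1}), k ≥ 1
open import Data.Nat using (_∸_; s≤s; z≤n)
open import Data.Nat.Properties using (m≤m+n; +-suc)
open import Relation.Binary.PropositionalEquality using (sym; subst)

idxK : (k : ℕ) → 1 ≤ k → Fin (k + k)
idxK (suc k) _ = Data.Fin.fromℕ< {k} (s≤s (m≤m+n k (suc k)))

idxK1 : (k : ℕ) → 1 ≤ k → Fin (k + k)
idxK1 (suc k) _ = Data.Fin.fromℕ< {suc k}
  (s≤s (subst (λ m → suc k ≤ m) (sym (+-suc k k)) (s≤s (m≤m+n k k))))

-- Split the vertices of K_{2k} into A = {a_0, …, a_{k−1}} and B = {b_0, …, b_{k−1}}. Edges inside A get
-- colour 3; a_p b_i gets colour 1, 2 or 4 as p + i < k − 1, p + i = k − 1 or p + i ≥ k; inside B the path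
-- b_0 b_1 … b_{k−1} gets colour 2 and every other edge colour 3. Then σ(a_p) = 4k − 2 + 3p and
-- σ(b_i) = 4k − 2 + 3i − d_i, where d_i ∈ {1, 2} is the degree of b_i on the path: the residue mod 3
-- separates A from B, and σ is increasing along each side. Each colour occurs at most k − 1 times at a
-- vertex and colour 2 at most three times, so for k ≥ 5 every vertex, whatever the ordering, has at most
-- k − 2 edges of colour 2. For k = 3, 4 colour 2 is removed from B and the conditions are checked by
-- evaluation.
module Submission where

open import Defs
open import Data.Bool using (true; false; if_then_else_)
open import Data.Bool.Properties using (∨-comm)
open import Data.Empty using (⊥-elim)
open import Data.Fin using (Fin; toℕ; fromℕ<) renaming (_≟_ to _≟ᶠ_)
open import Data.Fin.Properties using (toℕ-injective; toℕ<n; toℕ-fromℕ<; all?)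
open import Data.List using ([]; _∷_; map; filter; length; allFin; tabulate)
open import Data.List.Properties using (map-cong; map-tabulate; filter-none)
open import Data.List.Relation.Unary.All using (universal)
open import Data.Nat using (ℕ; zero; suc; _+_; _*_; _∸_; _≤_; _<_; z≤n; s≤s; z<s; s<s)
open import Data.Nat.ListAction using (sum)
open import Data.Nat.Properties
open import Data.Nat.Tactic.RingSolver using (solve-∀; solve)
open import Data.Product using (Σ; Σ-syntax; _×_; _,_; proj₁; proj₂)
open import Data.Sum using (_⊎_; inj₁; inj₂; [_,_])
open import Function using (_∘_; id; _∋_)
open import Relation.Binary.Definitions using (tri<; tri≈; tri>)
open import Relation.Binary.PropositionalEquality
  using (_≡_; _≢_; refl; sym; trans; cong; cong₂; subst; module ≡-Reasoning)
open import Relation.Nullary using (Dec; yes; no; does; ¬_)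
open import Relation.Nullary.Decidable
  using (True; toWitness; dec-true; dec-false; ¬?; _×-dec_; _⊎-dec_; _→-dec_)
open import Relation.Unary using (Decidable)

-- Indicators and finite sums

𝟙 : ∀ {p} {P : Set p} → Dec P → ℕ
𝟙 P? = if does P? then 1 else 0

𝟙-yes : ∀ {p} {P : Set p} (P? : Dec P) → P → 𝟙 P? ≡ 1
𝟙-yes P? p = cong (if_then 1 else 0) (dec-true P? p)

𝟙-no : ∀ {p} {P : Set p} (P? : Dec P) → ¬ P → 𝟙 P? ≡ 0
𝟙-no P? ¬p = cong (if_then 1 else 0) (dec-false P? ¬p)

𝟙≤1 : ∀ {p} {P : Set p} (P? : Dec P) → 𝟙 P? ≤ 1
𝟙≤1 P? with does P?
... | true  = ≤-refl
... | false = z≤n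

𝟙-⊎ : ∀ {p q} {P : Set p} {Q : Set q} (P? : Dec P) (Q? : Dec Q) → 𝟙 (P? ⊎-dec Q?) ≤ 𝟙 P? + 𝟙 Q?
𝟙-⊎ P? Q? with does P? | does Q?
... | true  | _     = s≤s z≤n
... | false | true  = ≤-refl
... | false | false = z≤n

∑< : ℕ → (ℕ → ℕ) → ℕ
∑< zero    g = 0
∑< (suc n) g = g 0 + ∑< n (g ∘ suc)

syntax ∑< n (λ t → x) = ∑[ t < n ] x

∑-cong : ∀ n {g h : ℕ → ℕ} → (∀ {t} → t < n → g t ≡ h t) → ∑< n g ≡ ∑< n h
∑-cong zero    g≡h = refl
∑-cong (suc n) g≡h = cong₂ _+_ (g≡h z<s) (∑-cong n (g≡h ∘ s<s))

∑-+ : ∀ m n (g : ℕ → ℕ) → ∑< (m + n) g ≡ ∑< m g + ∑[ t < n ] g (m + t)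
∑-+ zero    n g = refl
∑-+ (suc m) n g = trans (cong (g 0 +_) (∑-+ m n (g ∘ suc))) (sym (+-assoc (g 0) _ _))

∑-const : ∀ n c → ∑[ t < n ] c ≡ n * c
∑-const zero    c = refl
∑-const (suc n) c = cong (c +_) (∑-const n c)

∑-distribʳ-* : ∀ n (g : ℕ → ℕ) c → ∑[ t < n ] (g t * c) ≡ ∑< n g * c
∑-distribʳ-* zero    g c = refl
∑-distribʳ-* (suc n) g c =
  trans (cong (g 0 * c +_) (∑-distribʳ-* n (g ∘ suc) c)) (sym (*-distribʳ-+ c (g 0) _))

∑-distrib-+ : ∀ n (g h : ℕ → ℕ) → ∑[ t < n ] (g t + h t) ≡ ∑< n g + ∑< n h
∑-distrib-+ zero    g h = refl
∑-distrib-+ (suc n) g h =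
  trans (cong (g 0 + h 0 +_) (∑-distrib-+ n (g ∘ suc) (h ∘ suc))) (interchange (g 0) (h 0) _ _)
  where
  interchange : ∀ a b c d → a + b + (c + d) ≡ a + c + (b + d)
  interchange = solve-∀

∑-mono-≤ : ∀ n {g h : ℕ → ℕ} → (∀ t → g t ≤ h t) → ∑< n g ≤ ∑< n h
∑-mono-≤ zero    g≤h = z≤n
∑-mono-≤ (suc n) g≤h = +-mono-≤ (g≤h 0) (∑-mono-≤ n (g≤h ∘ suc))

term≤∑ : ∀ n (g : ℕ → ℕ) {t} → t < n → g t ≤ ∑< n g
term≤∑ (suc n) g {zero}  _         = m≤m+n (g 0) _
term≤∑ (suc n) g {suc t} (s<s t<n) = ≤-trans (term≤∑ n (g ∘ suc) t<n) (m≤n+m _ (g 0))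

∑-remove : ∀ n (g : ℕ → ℕ) {p} → p < n → ∑[ t < n ] (if does (t ≟ p) then 0 else g t) + g p ≡ ∑< n g
∑-remove (suc n) g {zero}  _         = +-comm (∑< n (g ∘ suc)) (g 0)
∑-remove (suc n) g {suc p} (s<s p<n) = trans (+-assoc (g 0) _ (g (suc p))) (cong (g 0 +_) (∑-remove n (g ∘ suc) p<n))

∑-𝟙-≤1 : ∀ n {P : ℕ → Set} (P? : Decidable P) → (∀ {s t} → P s → P t → s ≡ t) →
  ∑[ t < n ] 𝟙 (P? t) ≤ 1
∑-𝟙-≤1 zero    P? unique = z≤n
∑-𝟙-≤1 (suc n) P? unique with P? 0
... | yes P0 = s≤s (≤-reflexive (trans (∑-cong n rest≡0) (trans (∑-const n 0) (*-zeroʳ n))))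
  where
  rest≡0 : ∀ {t} → t < n → 𝟙 (P? (suc t)) ≡ 0
  rest≡0 {t} _ = 𝟙-no (P? (suc t)) (λ P1+t → 0≢1+n (unique P0 P1+t))
... | no ¬P0 = ∑-𝟙-≤1 n (P? ∘ suc) (λ Ps Pt → suc-injective (unique Ps Pt))

sum-map-filter : ∀ {A : Set} {P : A → Set} (P? : Decidable P) (h : A → ℕ) xs →
  sum (map h (filter P? xs)) ≡ sum (map (λ x → if does (P? x) then h x else 0) xs)
sum-map-filter P? h []       = refl
sum-map-filter P? h (x ∷ xs) with does (P? x)
... | true  = cong (h x +_) (sum-map-filter P? h xs)
... | false = sum-map-filter P? h xs

length-filter : ∀ {A : Set} {P : A → Set} (P? : Decidable P) xs → length (filter P? xs) ≡ sum (map (𝟙 ∘ P?) xs)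
length-filter P? []       = refl
length-filter P? (x ∷ xs) with does (P? x)
... | true  = cong suc (length-filter P? xs)
... | false = length-filter P? xs

sum-allFin : ∀ n (g : ℕ → ℕ) → sum (map (g ∘ toℕ) (allFin n)) ≡ ∑< n g
sum-allFin n g = trans (cong sum (map-tabulate {n = n} id (g ∘ toℕ))) (sum-tabulate n g)
  where
  sum-tabulate : ∀ n (g : ℕ → ℕ) → sum (tabulate {n = n} (g ∘ toℕ)) ≡ ∑< n g
  sum-tabulate zero    g = refl
  sum-tabulate (suc n) g = cong (g 0 +_) (sum-tabulate n (g ∘ suc))

restrict : ∀ {n} → (ℕ → ℕ → ℕ) → EdgeCol n
restrict col u v = col (toℕ u) (toℕ v)

∑-allFin-except : ∀ {n} (v : Fin n) (g : ℕ → ℕ) →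
  sum (map (λ u → if does (¬? (u ≟ᶠ v)) then g (toℕ u) else 0) (allFin n)) + g (toℕ v) ≡ ∑< n g
∑-allFin-except {n} v g = begin
  sum (map (λ u → if does (¬? (u ≟ᶠ v)) then g (toℕ u) else 0) (allFin n)) + g (toℕ v)
    ≡⟨ cong (λ xs → sum xs + g (toℕ v)) (map-cong masked (allFin n)) ⟩
  sum (map (g′ ∘ toℕ) (allFin n)) + g (toℕ v)
    ≡⟨ cong (_+ g (toℕ v)) (sum-allFin n g′) ⟩
  ∑< n g′ + g (toℕ v)
    ≡⟨ ∑-remove n g (toℕ<n v) ⟩
  ∑< n g ∎
  where
  open ≡-Reasoning
  g′ : ℕ → ℕ
  g′ t = if does (t ≟ toℕ v) then 0 else g t
  masked : ∀ u → (if does (¬? (u ≟ᶠ v)) then g (toℕ u) else 0) ≡ g′ (toℕ u)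
  masked u with u ≟ᶠ v
  ... | yes refl = cong (if_then 0 else g (toℕ u)) (sym (dec-true (toℕ u ≟ toℕ u) refl))
  ... | no  u≢v  = cong (if_then 0 else g (toℕ u)) (sym (dec-false (toℕ u ≟ toℕ v) (u≢v ∘ toℕ-injective)))

∑-nbrs : ∀ {n} (v : Fin n) (g : ℕ → ℕ) → sum (map (g ∘ toℕ) (nbrs v)) + g (toℕ v) ≡ ∑< n g
∑-nbrs {n} v g =
  trans (cong (_+ g (toℕ v)) (sum-map-filter (λ u → ¬? (u ≟ᶠ v)) (g ∘ toℕ) (allFin n))) (∑-allFin-except v g)

σ-restrict : ∀ {n} (col : ℕ → ℕ → ℕ) (v : Fin n) →
  σ (restrict col) v + col (toℕ v) (toℕ v) ≡ ∑< n (col (toℕ v))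
σ-restrict col v = ∑-nbrs v (col (toℕ v))

colDeg-restrict : ∀ {n} (col : ℕ → ℕ → ℕ) (v : Fin n) c →
  colDeg (restrict col) v c + 𝟙 (col (toℕ v) (toℕ v) ≟ c) ≡ ∑[ t < n ] 𝟙 (col (toℕ v) t ≟ c)
colDeg-restrict col v c =
  trans (cong (_+ 𝟙 (col (toℕ v) (toℕ v) ≟ c)) (length-filter (λ u → col (toℕ v) (toℕ u) ≟ c) (nbrs v)))
        (∑-nbrs v (λ t → 𝟙 (col (toℕ v) t ≟ c)))

length-nbrs : ∀ {n} (v : Fin n) → length (nbrs v) + 1 ≡ n
length-nbrs {n} v = begin
  length (nbrs v) + 1
    ≡⟨ cong (_+ 1) (length-filter (λ u → ¬? (u ≟ᶠ v)) (allFin n)) ⟩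
  sum (map (λ u → 𝟙 (¬? (u ≟ᶠ v))) (allFin n)) + 1
    ≡⟨ ∑-allFin-except v (λ _ → 1) ⟩
  ∑[ t < n ] 1
    ≡⟨ trans (∑-const n 1) (*-identityʳ n) ⟩
  n ∎
  where open ≡-Reasoning

-- The colouring

-- Vertex x < k is a_x and vertex k + i is b_i; crossColour k (p + i) is the colour of a_p b_i.
crossColour : ℕ → ℕ → ℕ
crossColour k t = if does (suc t <? k) then 1 else if does (suc t ≟ k) then 2 else 4

blockColour : ℕ → (ℕ → ℕ → ℕ) → ℕ → ℕ → ℕ
blockColour k inner x y =
  if does (x <? k)
  then (if does (y <? k) then 3 else crossColour k (x + (y ∸ k)))
  else (if does (y <? k) then crossColour k (y + (x ∸ k)) else inner (x ∸ k) (y ∸ k))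

crossColour-1 : ∀ {k t} → suc t < k → crossColour k t ≡ 1
crossColour-1 {k} {t} lt rewrite dec-true (suc t <? k) lt = refl

crossColour-2 : ∀ {k t} → suc t ≡ k → crossColour k t ≡ 2
crossColour-2 {k} {t} eq rewrite dec-false (suc t <? k) (<-irrefl eq) | dec-true (suc t ≟ k) eq = refl

crossColour-4 : ∀ {k t} → k ≤ t → crossColour k t ≡ 4
crossColour-4 {k} {t} k≤t
  rewrite dec-false (suc t <? k) (<-asym (s≤s k≤t))
        | dec-false (suc t ≟ k) (λ eq → <-irrefl (sym eq) (s≤s k≤t)) = refl

crossColour-range : ∀ k t → 1 ≤ crossColour k t × crossColour k t ≤ 4
crossColour-range k t with does (suc t <? k) | does (suc t ≟ k)
... | true  | _     = s≤s z≤n , s≤s z≤n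
... | false | true  = s≤s z≤n , s≤s (s≤s z≤n)
... | false | false = s≤s z≤n , ≤-refl

module _ {k : ℕ} {inner : ℕ → ℕ → ℕ} where

  k+i≮k : ∀ i → ¬ k + i < k
  k+i≮k i lt = <-irrefl refl (<-≤-trans lt (m≤m+n k i))

  blockColour-AA : ∀ {x y} → x < k → y < k → blockColour k inner x y ≡ 3
  blockColour-AA {x} {y} x<k y<k rewrite dec-true (x <? k) x<k | dec-true (y <? k) y<k = refl

  blockColour-AB : ∀ {x} t → x < k → blockColour k inner x (k + t) ≡ crossColour k (x + t)
  blockColour-AB {x} t x<k
    rewrite dec-true (x <? k) x<k | dec-false (k + t <? k) (k+i≮k t) | m+n∸m≡n k t = refl

  blockColour-BA : ∀ i {t} → t < k → blockColour k inner (k + i) t ≡ crossColour k (t + i)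
  blockColour-BA i {t} t<k
    rewrite dec-false (k + i <? k) (k+i≮k i) | dec-true (t <? k) t<k | m+n∸m≡n k i = refl

  blockColour-BB : ∀ i t → blockColour k inner (k + i) (k + t) ≡ inner i t
  blockColour-BB i t
    rewrite dec-false (k + i <? k) (k+i≮k i) | dec-false (k + t <? k) (k+i≮k t)
          | m+n∸m≡n k i | m+n∸m≡n k t = refl

  blockColour-sym : (∀ i j → inner i j ≡ inner j i) →
    ∀ x y → blockColour k inner x y ≡ blockColour k inner y x
  blockColour-sym inner-sym x y with does (x <? k) | does (y <? k)
  ... | true  | true  = refl
  ... | true  | false = refl
  ... | false | true  = refl
  ... | false | false = inner-sym (x ∸ k) (y ∸ k)

  blockColour-range : (∀ i j → 1 ≤ inner i j × inner i j ≤ 4) →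
    ∀ x y → 1 ≤ blockColour k inner x y × blockColour k inner x y ≤ 4
  blockColour-range inner-range x y with does (x <? k) | does (y <? k)
  ... | true  | true  = s≤s z≤n , s≤s (s≤s (s≤s z≤n))
  ... | true  | false = crossColour-range k (x + (y ∸ k))
  ... | false | true  = crossColour-range k (y + (x ∸ k))
  ... | false | false = inner-range (x ∸ k) (y ∸ k)

  blockColour-diag : (∀ i → inner i i ≡ 3) → ∀ x → blockColour k inner x x ≡ 3
  blockColour-diag inner-diag x with does (x <? k)
  ... | true  = refl
  ... | false = inner-diag (x ∸ k)

consecutive? : (i j : ℕ) → Dec (suc i ≡ j ⊎ suc j ≡ i)
consecutive? i j = (suc i ≟ j) ⊎-dec (suc j ≟ i)

pathColour : ℕ → ℕ → ℕ
pathColour i j = if does (consecutive? i j) then 2 else 3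

pathDegree : ℕ → ℕ → ℕ
pathDegree i n = ∑[ t < n ] 𝟙 (consecutive? i t)

pathColour-sym : ∀ i j → pathColour i j ≡ pathColour j i
pathColour-sym i j = cong (if_then 2 else 3) (∨-comm (does (suc i ≟ j)) (does (suc j ≟ i)))

pathColour-range : ∀ i j → 1 ≤ pathColour i j × pathColour i j ≤ 4
pathColour-range i j with does (consecutive? i j)
... | true  = s≤s z≤n , s≤s (s≤s z≤n)
... | false = s≤s z≤n , s≤s (s≤s (s≤s z≤n))

pathColour-diag : ∀ i → pathColour i i ≡ 3
pathColour-diag i = cong (if_then 2 else 3) (dec-false (consecutive? i i) [ 1+n≢n , 1+n≢n ])

pathDegree≤2 : ∀ i n → pathDegree i n ≤ 2
pathDegree≤2 i n = begin
  ∑[ t < n ] 𝟙 (consecutive? i t)                     ≤⟨ ∑-mono-≤ n (λ t → 𝟙-⊎ (suc i ≟ t) (suc t ≟ i)) ⟩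
  ∑[ t < n ] (𝟙 (suc i ≟ t) + 𝟙 (suc t ≟ i))          ≡⟨ ∑-distrib-+ n _ _ ⟩
  ∑[ t < n ] 𝟙 (suc i ≟ t) + ∑[ t < n ] 𝟙 (suc t ≟ i) ≤⟨ +-mono-≤ right-once left-once ⟩
  2                                                   ∎
  where
  open ≤-Reasoning
  right-once : ∑[ t < n ] 𝟙 (suc i ≟ t) ≤ 1
  right-once = ∑-𝟙-≤1 n (suc i ≟_) (λ p q → trans (sym p) q)
  left-once : ∑[ t < n ] 𝟙 (suc t ≟ i) ≤ 1
  left-once = ∑-𝟙-≤1 n (λ t → suc t ≟ i) (λ p q → suc-injective (trans p (sym q)))

pathDegree≤n : ∀ i n → pathDegree i n ≤ n
pathDegree≤n i n =
  ≤-trans (∑-mono-≤ n (λ t → 𝟙≤1 (consecutive? i t))) (≤-reflexive (trans (∑-const n 1) (*-identityʳ n)))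

1≤pathDegree : ∀ {i n} → 2 ≤ n → i < n → 1 ≤ pathDegree i n
1≤pathDegree {zero}  {n} 2≤n _     = term≤∑ n (λ t → 𝟙 (consecutive? 0 t)) 2≤n
1≤pathDegree {suc i} {n} _   1+i<n =
  ≤-trans (≤-reflexive (sym (𝟙-yes (consecutive? (suc i) i) (inj₂ refl))))
          (term≤∑ n (λ t → 𝟙 (consecutive? (suc i) t)) (<-trans (n<1+n i) 1+i<n))

∑-pathColour-traded : ∀ i n (Φ : ℕ → ℕ) →
  ∑[ t < n ] Φ (pathColour i t) + pathDegree i n * Φ 3 ≡ n * Φ 3 + pathDegree i n * Φ 2
∑-pathColour-traded i n Φ = begin
  ∑[ t < n ] Φ (pathColour i t) + ∑< n e * Φ 3
    ≡⟨ cong (∑[ t < n ] Φ (pathColour i t) +_) (sym (∑-distribʳ-* n e (Φ 3))) ⟩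
  ∑[ t < n ] Φ (pathColour i t) + ∑[ t < n ] (e t * Φ 3)
    ≡⟨ sym (∑-distrib-+ n _ _) ⟩
  ∑[ t < n ] (Φ (pathColour i t) + e t * Φ 3)
    ≡⟨ ∑-cong n (λ {t} _ → trade (does (consecutive? i t))) ⟩
  ∑[ t < n ] (Φ 3 + e t * Φ 2)
    ≡⟨ ∑-distrib-+ n _ _ ⟩
  ∑[ t < n ] Φ 3 + ∑[ t < n ] (e t * Φ 2)
    ≡⟨ cong₂ _+_ (∑-const n (Φ 3)) (∑-distribʳ-* n e (Φ 2)) ⟩
  n * Φ 3 + ∑< n e * Φ 2 ∎
  where
  open ≡-Reasoning
  e : ℕ → ℕ
  e t = 𝟙 (consecutive? i t)
  x+1*y≡y+1*x : ∀ x y → x + 1 * y ≡ y + 1 * x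
  x+1*y≡y+1*x = solve-∀
  trade : ∀ b → Φ (if b then 2 else 3) + (if b then 1 else 0) * Φ 3 ≡ Φ 3 + (if b then 1 else 0) * Φ 2
  trade true  = x+1*y≡y+1*x (Φ 2) (Φ 3)
  trade false = refl

∑-pathColour : ∀ i n (Φ : ℕ → ℕ) →
  ∑[ t < n ] Φ (pathColour i t) ≡ (n ∸ pathDegree i n) * Φ 3 + pathDegree i n * Φ 2
∑-pathColour i n Φ = +-cancelʳ-≡ (N * Φ 3) _ _ (begin
  ∑[ t < n ] Φ (pathColour i t) + N * Φ 3 ≡⟨ ∑-pathColour-traded i n Φ ⟩
  n * Φ 3 + N * Φ 2                       ≡⟨ cong (λ m → m * Φ 3 + N * Φ 2) (sym (m∸n+n≡m N≤n)) ⟩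
  (n ∸ N + N) * Φ 3 + N * Φ 2             ≡⟨ rearrange (n ∸ N) N (Φ 2) (Φ 3) ⟩
  (n ∸ N) * Φ 3 + N * Φ 2 + N * Φ 3       ∎)
  where
  open ≡-Reasoning
  N = pathDegree i n
  N≤n : N ≤ n
  N≤n = pathDegree≤n i n
  rearrange : ∀ m n x y → (m + n) * y + n * x ≡ m * y + n * x + n * y
  rearrange = solve-∀

∑-crossColour : ∀ a p (Φ : ℕ → ℕ) →
  ∑[ t < a + suc p ] Φ (crossColour (a + suc p) (p + t)) ≡ a * Φ 1 + Φ 2 + p * Φ 4
∑-crossColour a p Φ = begin
  ∑< k g                                          ≡⟨ ∑-+ a (suc p) g ⟩
  ∑< a g + (g (a + 0) + ∑[ t < p ] g (a + suc t)) ≡⟨ cong₂ _+_ colour-1 (cong₂ _+_ colour-2 colour-4) ⟩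
  a * Φ 1 + (Φ 2 + p * Φ 4)                       ≡⟨ sym (+-assoc (a * Φ 1) (Φ 2) (p * Φ 4)) ⟩
  a * Φ 1 + Φ 2 + p * Φ 4                         ∎
  where
  open ≡-Reasoning
  k = a + suc p
  g : ℕ → ℕ
  g t = Φ (crossColour k (p + t))
  1+p+a≡k : suc (p + a) ≡ k
  1+p+a≡k = trans (cong suc (+-comm p a)) (sym (+-suc a p))
  colour-1 : ∑< a g ≡ a * Φ 1
  colour-1 = trans (∑-cong a (λ t<a → cong Φ (crossColour-1 (1+p+t<k t<a)))) (∑-const a (Φ 1))
    where
    1+p+t<k : ∀ {t} → t < a → suc (p + t) < k
    1+p+t<k {t} t<a = subst (suc (p + t) <_) 1+p+a≡k (s<s (+-monoʳ-< p t<a))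
  colour-2 : g (a + 0) ≡ Φ 2
  colour-2 = cong Φ (crossColour-2 (trans (cong (suc ∘ (p +_)) (+-identityʳ a)) 1+p+a≡k))
  colour-4 : ∑[ t < p ] g (a + suc t) ≡ p * Φ 4
  colour-4 = trans (∑-cong p (λ {t} _ → cong Φ (crossColour-4 (subst (k ≤_) (reorder t) (m≤n+m k t)))))
                   (∑-const p (Φ 4))
    where
    reorder : ∀ t → t + (a + suc p) ≡ p + (a + suc t)
    reorder t = solve (t ∷ a ∷ p ∷ [])

-- Rows as colour multisets

record ColourMultiset : Set where
  constructor ⟨_,_,_,_⟩
  field ones twos threes fours : ℕ

open ColourMultiset

sumOver : ColourMultiset → (ℕ → ℕ) → ℕ
sumOver ⟨ n₁ , n₂ , n₃ , n₄ ⟩ Φ = n₁ * Φ 1 + n₂ * Φ 2 + n₃ * Φ 3 + n₄ * Φ 4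

multiplicity : ColourMultiset → ℕ → ℕ
multiplicity m 1 = ones m
multiplicity m 2 = twos m
multiplicity m 3 = threes m
multiplicity m 4 = fours m
multiplicity m _ = 0

sumOver-𝟙 : ∀ m c → sumOver m (λ y → 𝟙 (y ≟ c)) ≡ multiplicity m c
sumOver-𝟙 ⟨ n₁ , n₂ , n₃ , n₄ ⟩ 0 =
  (n₁ * 0 + n₂ * 0 + n₃ * 0 + n₄ * 0 ≡ 0) ∋ solve (n₁ ∷ n₂ ∷ n₃ ∷ n₄ ∷ [])
sumOver-𝟙 ⟨ n₁ , n₂ , n₃ , n₄ ⟩ 1 =
  (n₁ * 1 + n₂ * 0 + n₃ * 0 + n₄ * 0 ≡ n₁) ∋ solve (n₁ ∷ n₂ ∷ n₃ ∷ n₄ ∷ [])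
sumOver-𝟙 ⟨ n₁ , n₂ , n₃ , n₄ ⟩ 2 =
  (n₁ * 0 + n₂ * 1 + n₃ * 0 + n₄ * 0 ≡ n₂) ∋ solve (n₁ ∷ n₂ ∷ n₃ ∷ n₄ ∷ [])
sumOver-𝟙 ⟨ n₁ , n₂ , n₃ , n₄ ⟩ 3 =
  (n₁ * 0 + n₂ * 0 + n₃ * 1 + n₄ * 0 ≡ n₃) ∋ solve (n₁ ∷ n₂ ∷ n₃ ∷ n₄ ∷ [])
sumOver-𝟙 ⟨ n₁ , n₂ , n₃ , n₄ ⟩ 4 =
  (n₁ * 0 + n₂ * 0 + n₃ * 0 + n₄ * 1 ≡ n₄) ∋ solve (n₁ ∷ n₂ ∷ n₃ ∷ n₄ ∷ [])
sumOver-𝟙 ⟨ n₁ , n₂ , n₃ , n₄ ⟩ (suc (suc (suc (suc (suc _))))) =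
  (n₁ * 0 + n₂ * 0 + n₃ * 0 + n₄ * 0 ≡ 0) ∋ solve (n₁ ∷ n₂ ∷ n₃ ∷ n₄ ∷ [])

data Half (k : ℕ) : ℕ → Set where
  inA : ∀ a p → a + suc p ≡ k → Half k p
  inB : ∀ a i → a + suc i ≡ k → Half k (k + i)

half : ∀ k {x} → x < k + k → Half k x
half k {x} x<2k with x <? k
... | yes x<k = inA (k ∸ suc x) x (m∸n+n≡m x<k)
... | no  x≮k with i , refl ← m≤n⇒∃[o]m+o≡n (≮⇒≥ x≮k) =
  inB (k ∸ suc i) i (m∸n+n≡m (+-cancelˡ-< k i k x<2k))

colouring : ℕ → ℕ → ℕ → ℕ
colouring k = blockColour k pathColour

-- Rows include the diagonal entry, of colour 3: hence threes = k on A and the 𝟙 (3 ≟ c) corrections below.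
rowMultiset : ∀ {k x} → Half k x → ColourMultiset
rowMultiset {k} (inA a p _) = ⟨ a , 1 , k , p ⟩
rowMultiset {k} (inB a i _) = ⟨ a , 1 + pathDegree i k , k ∸ pathDegree i k , i ⟩

∑-row : ∀ {k x} (h : Half k x) (Φ : ℕ → ℕ) → ∑[ t < k + k ] Φ (colouring k x t) ≡ sumOver (rowMultiset h) Φ
∑-row (inA a p refl) Φ = begin
  ∑[ t < k + k ] Φ (colouring k p t)                                     ≡⟨ ∑-+ k k _ ⟩
  ∑[ t < k ] Φ (colouring k p t) + ∑[ t < k ] Φ (colouring k p (k + t)) ≡⟨ cong₂ _+_ clique cross ⟩
  k * Φ 3 + (a * Φ 1 + Φ 2 + p * Φ 4)                                    ≡⟨ rearrange a k p _ _ _ _ ⟩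
  sumOver ⟨ a , 1 , k , p ⟩ Φ                                            ∎
  where
  open ≡-Reasoning
  k = a + suc p
  p<k : p < k
  p<k = m≤n+m (suc p) a
  clique : ∑[ t < k ] Φ (colouring k p t) ≡ k * Φ 3
  clique = trans (∑-cong k (λ t<k → cong Φ (blockColour-AA {inner = pathColour} p<k t<k))) (∑-const k (Φ 3))
  cross : ∑[ t < k ] Φ (colouring k p (k + t)) ≡ a * Φ 1 + Φ 2 + p * Φ 4
  cross = trans (∑-cong k (λ {t} _ → cong Φ (blockColour-AB {inner = pathColour} t p<k))) (∑-crossColour a p Φ)
  rearrange : ∀ a k p w x y z → k * y + (a * w + x + p * z) ≡ a * w + 1 * x + k * y + p * z
  rearrange = solve-∀
∑-row (inB a i refl) Φ = begin
  ∑[ t < k + k ] Φ (colouring k (k + i) t)                                           ≡⟨ ∑-+ k k _ ⟩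
  ∑[ t < k ] Φ (colouring k (k + i) t) + ∑[ t < k ] Φ (colouring k (k + i) (k + t)) ≡⟨ cong₂ _+_ cross path ⟩
  a * Φ 1 + Φ 2 + i * Φ 4 + ((k ∸ N) * Φ 3 + N * Φ 2)                              ≡⟨ rearrange a N (k ∸ N) i _ _ _ _ ⟩
  sumOver ⟨ a , 1 + N , k ∸ N , i ⟩ Φ                                                ∎
  where
  open ≡-Reasoning
  k = a + suc i
  N = pathDegree i k
  cross : ∑[ t < k ] Φ (colouring k (k + i) t) ≡ a * Φ 1 + Φ 2 + i * Φ 4
  cross = trans (∑-cong k (λ {t} t<k → cong Φ (trans (blockColour-BA {inner = pathColour} i t<k) (t+i≡i+t t))))
                (∑-crossColour a i Φ)
    where
    t+i≡i+t : ∀ t → crossColour k (t + i) ≡ crossColour k (i + t)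
    t+i≡i+t t = cong (crossColour k) (+-comm t i)
  path : ∑[ t < k ] Φ (colouring k (k + i) (k + t)) ≡ (k ∸ N) * Φ 3 + N * Φ 2
  path = trans (∑-cong k (λ {t} _ → cong Φ (blockColour-BB {k} {pathColour} i t))) (∑-pathColour i k Φ)
  rearrange : ∀ a n m i w x y z → a * w + x + i * z + (m * y + n * x) ≡ a * w + (1 + n) * x + m * y + i * z
  rearrange = solve-∀

record Balanced (k : ℕ) (m : ColourMultiset) : Set where
  field
    ones<k   : ones m < k
    twos≤3   : twos m ≤ 3
    threes≤k : threes m ≤ k
    fours<k  : fours m < k

row-balanced : ∀ {k x} (h : Half k x) → Balanced k (rowMultiset h)
row-balanced (inA a p refl) = record
  { ones<k = m<m+n a z<s ; twos≤3 = s≤s z≤n ; threes≤k = ≤-refl ; fours<k = m≤n+m (suc p) a }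
row-balanced (inB a i refl) = record
  { ones<k   = m<m+n a z<s
  ; twos≤3   = s≤s (pathDegree≤2 i (a + suc i))
  ; threes≤k = m∸n≤m (a + suc i) (pathDegree i (a + suc i))
  ; fours<k  = m≤n+m (suc i) a
  }

module _ {k : ℕ} {m : ColourMultiset} (4≤k : 4 ≤ k) (balanced : Balanced k m) where
  open Balanced balanced

  private
    below : ∀ {D n} → D + 0 ≡ n → n < k → D < k
    below {D} D+0≡n = subst (_< k) (trans (sym D+0≡n) (+-identityʳ D))

  balanced-degree< : ∀ {D} c → D + 𝟙 (3 ≟ c) ≡ multiplicity m c → D < k
  balanced-degree< {D} 3 D+1≡ = subst (_≤ k) (sym (trans (+-comm 1 D) D+1≡)) threes≤k
  balanced-degree< 1 D≡ = below D≡ ones<k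
  balanced-degree< 2 D≡ = below D≡ (<-≤-trans (s≤s twos≤3) 4≤k)
  balanced-degree< 4 D≡ = below D≡ fours<k
  balanced-degree< 0 D≡ = below D≡ (<-≤-trans z<s 4≤k)
  balanced-degree< (suc (suc (suc (suc (suc _))))) D≡ = below D≡ (<-≤-trans z<s 4≤k)

index : ∀ {k x} → Half k x → ℕ
index (inA _ p _) = p
index (inB _ i _) = i

index<k : ∀ {k x} (h : Half k x) → index h < k
index<k (inA a p e) = subst (p <_) e (m≤n+m (suc p) a)
index<k (inB a i e) = subst (i <_) e (m≤n+m (suc i) a)

defect : ∀ {k x} → Half k x → ℕ
defect     (inA _ _ _) = 0
defect {k} (inB _ i _) = pathDegree i k

defect≤2 : ∀ {k x} (h : Half k x) → defect h ≤ 2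
defect≤2     (inA _ _ _) = z≤n
defect≤2 {k} (inB _ i _) = pathDegree≤2 i k

sumOver-row : ∀ {k x} (h : Half k x) → sumOver (rowMultiset h) id + defect h ≡ 4 * k + 1 + 3 * index h
sumOver-row (inA a p refl) = clique a p
  where
  clique : ∀ a p → a * 1 + 1 * 2 + (a + suc p) * 3 + p * 4 + 0 ≡ 4 * (a + suc p) + 1 + 3 * p
  clique = solve-∀
sumOver-row (inB a i refl) = begin
  a * 1 + (1 + N) * 2 + (k ∸ N) * 3 + i * 4 + N ≡⟨ collect a i N (k ∸ N) ⟩
  k + 3 * (k ∸ N + N) + 1 + 3 * i                ≡⟨ cong (λ n → k + 3 * n + 1 + 3 * i) (m∸n+n≡m N≤k) ⟩
  4 * k + 1 + 3 * i                              ∎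
  where
  open ≡-Reasoning
  k = a + suc i
  N = pathDegree i k
  N≤k : N ≤ k
  N≤k = pathDegree≤n i k
  collect : ∀ a i n m → a * 1 + (1 + n) * 2 + m * 3 + i * 4 + n ≡ a + suc i + 3 * (m + n) + 1 + 3 * i
  collect = solve-∀

+-*3-gap : ∀ {s C i j d e} → s + d ≡ C + 3 * i → s + e ≡ C + 3 * j → i < j → 3 ≤ e
+-*3-gap {s} {C} {i} {j} {d} {e} sd se i<j = +-cancelˡ-≤ s 3 e (begin
  s + 3          ≤⟨ +-monoˡ-≤ 3 (m≤m+n s d) ⟩
  s + d + 3      ≡⟨ cong (_+ 3) sd ⟩
  C + 3 * i + 3  ≡⟨ +-*-suc C i ⟩
  C + 3 * suc i  ≤⟨ +-monoʳ-≤ C (*-monoʳ-≤ 3 i<j) ⟩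
  C + 3 * j      ≡⟨ sym se ⟩
  s + e          ∎)
  where
  open ≤-Reasoning
  +-*-suc : ∀ C i → C + 3 * i + 3 ≡ C + 3 * suc i
  +-*-suc = solve-∀

+-*3-injective : ∀ {s C i j d e} → s + d ≡ C + 3 * i → s + e ≡ C + 3 * j → d ≤ 2 → e ≤ 2 →
  i ≡ j × d ≡ e
+-*3-injective {s} {C} {i} {j} {d} {e} sd se d≤2 e≤2 with <-cmp i j
... | tri< i<j _ _  = ⊥-elim (1+n≰n (≤-trans (+-*3-gap {C = C} sd se i<j) e≤2))
... | tri> _ _ j<i  = ⊥-elim (1+n≰n (≤-trans (+-*3-gap {C = C} se sd j<i) d≤2))
... | tri≈ _ refl _ = refl , +-cancelˡ-≡ s d e (trans sd (sym se))

half-injective : ∀ {k x y} → 2 ≤ k → (hx : Half k x) (hy : Half k y) →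
  index hx ≡ index hy → defect hx ≡ defect hy → x ≡ y
half-injective     _   (inA _ _ _) (inA _ _ _) p≡q _ = p≡q
half-injective {k} _   (inB _ _ _) (inB _ _ _) i≡j _ = cong (k +_) i≡j
half-injective     2≤k (inA _ _ _) hy@(inB _ _ _) _ 0≡N = ⊥-elim (<⇒≢ (1≤pathDegree 2≤k (index<k hy)) 0≡N)
half-injective     2≤k hx@(inB _ _ _) (inA _ _ _) _ N≡0 = ⊥-elim (<⇒≢ (1≤pathDegree 2≤k (index<k hx)) (sym N≡0))

colouring-diag : ∀ k x → colouring k x x ≡ 3
colouring-diag k = blockColour-diag {k} {pathColour} pathColour-diag

module _ (k : ℕ) (v : Fin (k + k)) where

  private
    h : Half k (toℕ v)
    h = half k (toℕ<n v)

  σ-colouring : σ (restrict (colouring k)) v + 3 + defect h ≡ 4 * k + 1 + 3 * index h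
  σ-colouring = begin
    σ (restrict (colouring k)) v + 3 + defect h
      ≡⟨ cong (λ d → σ (restrict (colouring k)) v + d + defect h) (sym (colouring-diag k (toℕ v))) ⟩
    σ (restrict (colouring k)) v + colouring k (toℕ v) (toℕ v) + defect h
      ≡⟨ cong (_+ defect h) (trans (σ-restrict (colouring k) v) (∑-row h id)) ⟩
    sumOver (rowMultiset h) id + defect h
      ≡⟨ sumOver-row h ⟩
    4 * k + 1 + 3 * index h ∎
    where open ≡-Reasoning

  colDeg-colouring : ∀ c → colDeg (restrict (colouring k)) v c + 𝟙 (3 ≟ c) ≡ multiplicity (rowMultiset h) c
  colDeg-colouring c = begin
    colDeg (restrict (colouring k)) v c + 𝟙 (3 ≟ c)
      ≡⟨ cong (λ d → colDeg (restrict (colouring k)) v c + 𝟙 (d ≟ c)) (sym (colouring-diag k (toℕ v))) ⟩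
    colDeg (restrict (colouring k)) v c + 𝟙 (colouring k (toℕ v) (toℕ v) ≟ c)
      ≡⟨ colDeg-restrict (colouring k) v c ⟩
    ∑[ t < k + k ] 𝟙 (colouring k (toℕ v) t ≟ c)
      ≡⟨ ∑-row h (λ y → 𝟙 (y ≟ c)) ⟩
    sumOver (rowMultiset h) (λ y → 𝟙 (y ≟ c))
      ≡⟨ sumOver-𝟙 (rowMultiset h) c ⟩
    multiplicity (rowMultiset h) c ∎
    where open ≡-Reasoning

colouring-isEdgeColoring : ∀ k → IsEdgeColoring (k + k) 4 (restrict (colouring k))
colouring-isEdgeColoring k =
  (λ u v _ → blockColour-sym {k} {pathColour} pathColour-sym (toℕ u) (toℕ v)) ,
  (λ u v _ → blockColour-range {k} {pathColour} pathColour-range (toℕ u) (toℕ v))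

colouring-nsd : ∀ k → 2 ≤ k → IsNSD (k + k) (restrict (colouring k))
colouring-nsd k 2≤k u v u≢v σu≡σv =
  u≢v (toℕ-injective (half-injective 2≤k hu hv (proj₁ same) (proj₂ same)))
  where
  hu = half k (toℕ<n u)
  hv = half k (toℕ<n v)
  same : index hu ≡ index hv × defect hu ≡ defect hv
  same = +-*3-injective {C = 4 * k + 1} (σ-colouring k u) σv-as-σu (defect≤2 hu) (defect≤2 hv)
    where
    σv-as-σu : σ (restrict (colouring k)) u + 3 + defect hv ≡ 4 * k + 1 + 3 * index hv
    σv-as-σu = subst (λ s → s + 3 + defect hv ≡ 4 * k + 1 + 3 * index hv) (sym σu≡σv) (σ-colouring k v)

<⇒2*≤ : ∀ {D k L} → D < k → L + 1 ≡ k + k → 2 * D ≤ L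
<⇒2*≤ {D} {k} {L} D<k L+1≡k+k = <⇒≤ (≤-pred (begin
  suc (suc (2 * D)) ≡⟨ double-suc D ⟩
  suc D + suc D     ≤⟨ +-mono-≤ D<k D<k ⟩
  k + k             ≡⟨ sym L+1≡k+k ⟩
  L + 1             ≡⟨ +-comm L 1 ⟩
  suc L             ∎))
  where
  open ≤-Reasoning
  double-suc : ∀ D → suc (suc (2 * D)) ≡ suc D + suc D
  double-suc = solve-∀

colouring-majority : ∀ k → 4 ≤ k → IsMajority (k + k) (restrict (colouring k))
colouring-majority k 4≤k v c =
  <⇒2*≤ (balanced-degree< 4≤k (row-balanced (half k (toℕ<n v))) c (colDeg-colouring k v c)) (length-nbrs v)

colouring-colDeg-2 : ∀ k (v : Fin (k + k)) → colDeg (restrict (colouring k)) v 2 ≤ 3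
colouring-colDeg-2 k v = subst (_≤ 3) (trans (sym (colDeg-colouring k v 2)) (+-identityʳ _)) twos≤3
  where open Balanced (row-balanced (half k (toℕ<n v)))

GoodColouring : ℕ → Set
GoodColouring k =
  Σ[ c ∈ EdgeCol (k + k) ] IsEdgeColoring (k + k) 4 c × IsNSD (k + k) c × IsMajority (k + k) c ×
    (∀ v → colDeg c v 2 ≤ k ∸ 2)

colouring-good : ∀ k → 5 ≤ k → GoodColouring k
colouring-good k 5≤k =
  restrict (colouring k) , colouring-isEdgeColoring k , colouring-nsd k (≤-trans (s≤s (s≤s z≤n)) 5≤k) ,
  colouring-majority k (≤-trans (n≤1+n 4) 5≤k) , λ v → ≤-trans (colouring-colDeg-2 k v) (∸-monoˡ-≤ 2 5≤k)

colDeg-absent : ∀ {n} (c : EdgeCol n) v j → (∀ u → c v u ≢ j) → colDeg c v j ≡ 0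
colDeg-absent c v j c≢j = cong length (filter-none (λ u → c v u ≟ j) (universal c≢j (nbrs v)))

module Certificate (k : ℕ) (inner : ℕ → ℕ → ℕ) where

  c : EdgeCol (k + k)
  c = restrict (blockColour k inner)

  symmetric? : Dec (∀ u v → c u v ≡ c v u)
  symmetric? = all? λ u → all? λ v → c u v ≟ c v u

  inRange? : Dec (∀ u v → 1 ≤ c u v × c u v ≤ 4)
  inRange? = all? λ u → all? λ v → (1 ≤? c u v) ×-dec (c u v ≤? 4)

  nsd? : Dec (IsNSD (k + k) c)
  nsd? = all? λ u → all? λ v → ¬? (u ≟ᶠ v) →-dec ¬? (σ c u ≟ σ c v)

  majority? : Dec (∀ v (j : Fin 5) → 2 * colDeg c v (toℕ j) ≤ length (nbrs v))
  majority? = all? λ v → all? λ j → 2 * colDeg c v (toℕ j) ≤? length (nbrs v)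

  sparse2? : Dec (∀ v → colDeg c v 2 ≤ k ∸ 2)
  sparse2? = all? λ v → colDeg c v 2 ≤? k ∸ 2

  certified : True symmetric? → True inRange? → True nsd? → True majority? → True sparse2? → GoodColouring k
  certified sym✓ range✓ nsd✓ majority✓ sparse2✓ =
    c , ((λ u v _ → toWitness sym✓ u v) , (λ u v _ → toWitness range✓ u v)) , toWitness nsd✓ , majority ,
    toWitness sparse2✓
    where
    majority : IsMajority (k + k) c
    majority v j with j <? 5
    ... | yes j<5 =
      subst (λ j → 2 * colDeg c v j ≤ length (nbrs v)) (toℕ-fromℕ< j<5) (toWitness majority✓ v (fromℕ< j<5))
    ... | no  j≮5 = subst (λ d → 2 * d ≤ length (nbrs v)) (sym (colDeg-absent c v j colour≢j)) z≤n
      where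
      colour≢j : ∀ u → c v u ≢ j
      colour≢j u c≡j = j≮5 (s≤s (subst (_≤ 4) c≡j (proj₂ (toWitness range✓ v u))))

-- For k = 3, 4 the inner colourings avoid colour 2, so every vertex has a single edge of colour 2.
inner₃ : ℕ → ℕ → ℕ
inner₃ 0 1 = 4
inner₃ 1 0 = 4
inner₃ 1 2 = 1
inner₃ 2 1 = 1
inner₃ _ _ = 3

inner₄ : ℕ → ℕ → ℕ
inner₄ 0 1 = 4
inner₄ 1 0 = 4
inner₄ 1 3 = 1
inner₄ 3 1 = 1
inner₄ 2 3 = 1
inner₄ 3 2 = 1
inner₄ _ _ = 3

goodColouring : ∀ k → 3 ≤ k → GoodColouring k
goodColouring 1 (s≤s ())
goodColouring 2 (s≤s (s≤s ()))
goodColouring 3 _ = Certificate.certified 3 inner₃ _ _ _ _ _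
goodColouring 4 _ = Certificate.certified 4 inner₄ _ _ _ _ _
goodColouring (suc (suc (suc (suc (suc m))))) _ = colouring-good (5 + m) (s≤s (s≤s (s≤s (s≤s (s≤s z≤n)))))

mainTheorem20 : (k : ℕ) → (h : 3 ≤ k) →
    Σ (EdgeCol (k + k)) λ c →
      IsEdgeColoring (k + k) 4 c × IsNSD (k + k) c × IsMajority (k + k) c ×
      ((ord : Fin (k + k) → Fin (k + k)) →
       (∀ i j → toℕ i < toℕ j → σ c (ord i) < σ c (ord j)) →
       (colDeg c (ord (idxK k (≤-trans (s≤s z≤n) h))) 2 ≤ k ∸ 2)
       ⊎ (colDeg c (ord (idxK1 k (≤-trans (s≤s z≤n) h))) 3 ≤ k ∸ 2))
mainTheorem20 k h =
  let c , isColouring , nsd , majority , sparse = goodColouring k h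
  in c , isColouring , nsd , majority , λ ord _ → inj₁ (sparse (ord (idxK k (≤-trans (s≤s z≤n) h))))
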